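{- Let $\mathcal{U}$ be the universal $n$-maniplex and let $(\mathcal{Y},\eta)$ be an $(n,m)$-voltage operator. Then the derived graph $\mathcal{Y}^\eta$ is isomorphic to $\mathcal{U}\rtimes_\eta\mathcal{Y}$.
   Context: Graphs may have semiedges and parallel edges. A $k$-premaniplex is a graph whose darts are colored by $\{0,\dots,k-1\}$ (a dart and its inverse have the same color) such that every vertex is the starting point of exactly one dart of each color, and for $|i-j|\ge 2$ every path of length 4 alternating colors $i,j$ is closed. For a vertex $x$, ${}^i x$ denotes the dart of color $i$ starting at $x$, and $x^i$ its endpoint. The universal Coxeter group is $\mathcal C^n=\langle\rho_0,\dots,\rho_{n-1}\mid\rho_i^2=1,\ (\rho_i\rho_j)^2=1\text{ for }|i-j|\ge2\rangle$, and the universal $n$-maniplex $\mathcal U=\mathcal U^n$ is its Cayley graph: vertex set $\mathcal C^n$, with the $i$-adjacent vertex of $\gamma$ being $\rho_i\gamma$. The group $\mathrm{Mon}(\mathcal U^n)=\langle r_0,\dots,r_{n-1}\mid r_i^2=1,\ (r_ir_j)^2=1 \text{ for } |i-j|\ge2\rangle$ acts on the left on the vertex set of every $n$-premaniplex by $r_i x=x^i$. A voltage assignment $\eta$ with group $G$ assigns $\eta(d)\in G$ to each dart $d$ with $\eta(d^{ -1})=\eta(d)^{ -1}$; the voltage of a path $d_1\cdots d_k$ is $\eta(d_k)\cdots\eta(d_1)$. The derived graph $\mathcal Y^\eta$ has vertex set $V(\mathcal Y)\times G$ and $(y,g)^i=(y^i,\eta({}^i y)g)$. An $(n,m)$-voltage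 operator is a pair $(\mathcal Y,\eta)$ with $\mathcal Y$ an $m$-premaniplex and $\eta$ a voltage assignment with group $\mathrm{Mon}(\mathcal U^n)$ such that every length-4 path alternating between colors $i,j$ with $|i-j|\ge2$ has trivial voltage. For an $n$-premaniplex $\mathcal X$, $\mathcal X\rtimes_\eta\mathcal Y$ is the $m$-premaniplex on $V(\mathcal X)\times V(\mathcal Y)$ where for each color $i$ there is an edge of color $i$ joining $(x,y)$ and $(\eta({}^i y)x,\ y^i)$. -}

module Defs where

open import Data.Nat using (ℕ; _≤_; ∣_-_∣)
open import Data.Nat.Properties using (∣-∣-comm)
open import Data.Fin using (Fin; toℕ)
open import Data.List using (List; []; _∷_; _++_)
open import Data.List.Properties using (++-assoc)
open import Data.Product using (_×_; _,_; proj₁; proj₂; Σ)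
open import Relation.Binary.Structures using (IsEquivalence)
open import Relation.Binary.PropositionalEquality using (_≡_; refl; subst)

Far : {k : ℕ} → Fin k → Fin k → Set
Far i j = 2 ≤ ∣ toℕ i - toℕ j ∣

Far-sym : {k : ℕ} (i j : Fin k) → Far i j → Far j i
Far-sym i j p = subst (2 ≤_) (∣-∣-comm (toℕ i) (toℕ j)) p

-- k-coloured graphs in which every vertex is the start of exactly one
-- dart of each colour.  Such a graph (semiedges and parallel edges
-- allowed) is determined by the involutions x ↦ x^i; the dart ^i x is
-- identified with the pair (i , x), its inverse being (i , x^i).
-- Vertex sets are setoids, since some vertex sets are groups given by
-- a presentation.

record Graph (k : ℕ) : Set₁ where
  field
    Carrier : Set
    _≈_     : Carrier → Carrier → Set
    isEquiv : IsEquivalence _≈_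
    adj     : Fin k → Carrier → Carrier
    adj-cong : ∀ i {x y} → x ≈ y → adj i x ≈ adj i y

record Premaniplex (k : ℕ) : Set₁ where
  field
    graph : Graph k
  open Graph graph public
  field
    adj-invol : ∀ i x → adj i (adj i x) ≈ x
    adj-far   : ∀ i j → Far i j → ∀ x → adj j (adj i (adj j (adj i x))) ≈ x

record _≅_ {k : ℕ} (A B : Graph k) : Set where
  private
    module A = Graph A
    module B = Graph B
  field
    to       : A.Carrier → B.Carrier
    to-cong  : ∀ {x y} → x A.≈ y → to x B.≈ to y
    to-adj   : ∀ i x → to (A.adj i x) B.≈ B.adj i (to x)
    injective  : ∀ {x y} → to x B.≈ to y → x A.≈ y
    surjective : ∀ b → Σ A.Carrier (λ a → to a B.≈ b)

-- The universal Coxeter group C^n (≅ Mon(U^n)), presented by generators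
-- and relations: words in the generators modulo the congruence generated
-- by ρ_i ρ_i = 1 and (ρ_i ρ_j)^2 = 1 for |i-j| ≥ 2.
-- The word i₁ ∷ i₂ ∷ ... ∷ i_k represents ρ_{i₁} ρ_{i₂} ⋯ ρ_{i_k};
-- multiplication is _++_, the identity is [].

Word : ℕ → Set
Word n = List (Fin n)

infix 4 _∼_
data _∼_ {n : ℕ} : Word n → Word n → Set where
  ∼-refl  : ∀ {u} → u ∼ u
  ∼-sym   : ∀ {u v} → u ∼ v → v ∼ u
  ∼-trans : ∀ {u v w} → u ∼ v → v ∼ w → u ∼ w
  ∼-cong  : ∀ {u u′ v v′} → u ∼ u′ → v ∼ v′ → u ++ v ∼ u′ ++ v′
  ∼-inv   : ∀ i → i ∷ i ∷ [] ∼ []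
  ∼-far   : ∀ i j → Far i j → i ∷ j ∷ i ∷ j ∷ [] ∼ []

∼-isEquiv : {n : ℕ} → IsEquivalence (_∼_ {n})
∼-isEquiv = record { refl = ∼-refl ; sym = ∼-sym ; trans = ∼-trans }

-- Mon(U^n): same presentation, generators r_i.
Mon : ℕ → Set
Mon = Word

-- The universal n-maniplex U^n: Cayley graph of C^n, γ^i = ρ_i γ.

UGraph : (n : ℕ) → Graph n
UGraph n = record
  { Carrier = Word n ; _≈_ = _∼_ ; isEquiv = ∼-isEquiv
  ; adj = λ i γ → i ∷ γ
  ; adj-cong = λ i p → ∼-cong {u = i ∷ []} ∼-refl p }

U : (n : ℕ) → Premaniplex n
U n = record
  { graph = UGraph n
  ; adj-invol = λ i γ → ∼-cong {v = γ} (∼-inv i) ∼-refl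
  ; adj-far = λ i j f γ → ∼-cong {v = γ} (∼-far j i (Far-sym i j f)) ∼-refl }

act : {n : ℕ} (X : Premaniplex n) → Mon n → Premaniplex.Carrier X → Premaniplex.Carrier X
act X []      x = x
act X (i ∷ w) x = Premaniplex.adj X i (act X w x)

module _ {n : ℕ} (X : Premaniplex n) where
  open Premaniplex X
  private
    module E = IsEquivalence isEquiv

  act-++ : ∀ u v x → act X (u ++ v) x ≡ act X u (act X v x)
  act-++ []      v x = refl
  act-++ (i ∷ u) v x rewrite act-++ u v x = refl

  act-congʳ : ∀ w {x y} → x ≈ y → act X w x ≈ act X w y
  act-congʳ []      p = p
  act-congʳ (i ∷ w) p = adj-cong i (act-congʳ w p)

  act-cong : ∀ {u v} → u ∼ v → ∀ {x y} → x ≈ y → act X u x ≈ act X v y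
  act-cong (∼-refl {u}) {x} {y} p = act-congʳ u p
  act-cong (∼-sym q) p = E.sym (act-cong q (E.sym p))
  act-cong (∼-trans q r) p = E.trans (act-cong q p) (act-cong r E.refl)
  act-cong (∼-cong {u} {u′} {v} {v′} q r) {x} {y} p
    rewrite act-++ u v x | act-++ u′ v′ y = act-cong q (act-cong r p)
  act-cong (∼-inv i) {x} {y} p = E.trans (adj-invol i x) p
  act-cong (∼-far i j f) {x} {y} p = E.trans (adj-far j i (Far-sym i j f) x) p

-- (n,m)-voltage operators.  η assigns to the dart ^i y the voltage η i y.
-- η(d⁻¹) = η(d)⁻¹ is written η(d⁻¹) η(d) = 1.  The voltage of the path
-- d₁d₂d₃d₄ is η(d₄)η(d₃)η(d₂)η(d₁).

record VoltageOperator (n m : ℕ) (Y : Premaniplex m) : Set where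
  open Premaniplex Y
  field
    η       : Fin m → Carrier → Mon n
    η-cong  : ∀ i {y y′} → y ≈ y′ → η i y ∼ η i y′
    η-inv   : ∀ i y → η i (adj i y) ++ η i y ∼ []
    η-far   : ∀ i j → Far i j → ∀ y →
              η j (adj i (adj j (adj i y)))
                ++ (η i (adj j (adj i y)) ++ (η j (adj i y) ++ η i y)) ∼ []

Derived : {n m : ℕ} {Y : Premaniplex m} → VoltageOperator n m Y → Graph m
Derived {n} {m} {Y} V = record
  { Carrier = Carrier × Mon n
  ; _≈_ = λ a b → (proj₁ a ≈ proj₁ b) × (proj₂ a ∼ proj₂ b)
  ; isEquiv = record
      { refl = E.refl , ∼-refl
      ; sym = λ (p , q) → E.sym p , ∼-sym q
      ; trans = λ (p , q) (p′ , q′) → E.trans p p′ , ∼-trans q q′ }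
  ; adj = λ i (y , g) → adj i y , η i y ++ g
  ; adj-cong = λ i (p , q) → adj-cong i p , ∼-cong (η-cong i p) q }
  where
    open Premaniplex Y
    open VoltageOperator V
    module E = IsEquivalence isEquiv

Semidirect : {n m : ℕ} (X : Premaniplex n) {Y : Premaniplex m} →
             VoltageOperator n m Y → Graph m
Semidirect {n} {m} X {Y} V = record
  { Carrier = X.Carrier × Y.Carrier
  ; _≈_ = λ a b → (proj₁ a X.≈ proj₁ b) × (proj₂ a Y.≈ proj₂ b)
  ; isEquiv = record
      { refl = EX.refl , EY.refl
      ; sym = λ (p , q) → EX.sym p , EY.sym q
      ; trans = λ (p , q) (p′ , q′) → EX.trans p p′ , EY.trans q q′ }
  ; adj = λ i (x , y) → act X (η i y) x , Y.adj i y
  ; adj-cong = λ i (p , q) → act-cong X (η-cong i q) p , Y.adj-cong i q }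
  where
    module X = Premaniplex X
    module Y = Premaniplex Y
    open VoltageOperator V
    module EX = IsEquivalence X.isEquiv
    module EY = IsEquivalence Y.isEquiv

{-# OPTIONS --safe #-}
-- Mon(U^n) acts on U^n = Cay(C^n) by left multiplication, so the i-edge of
-- U ⋊_η Y joining (g, y) and (η(^i y) g, y^i) is the i-edge of Y^η joining
-- (y, g) and (y^i, η(^i y) g) with its coordinates swapped.
module Submission where

open import Defs
open import Data.Nat using (ℕ)
open import Data.List using ([]; _∷_; _++_)
open import Data.Product using (_,_)
open import Relation.Binary.Structures using (IsEquivalence)
open import Relation.Binary.PropositionalEquality using (_≡_; refl; cong)

act-U : ∀ {n} (w g : Word n) → act (U n) w g ≡ w ++ g
act-U []      g = refl
act-U (i ∷ w) g = cong (i ∷_) (act-U w g)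

theorem7p1 : (n m : ℕ) (Y : Premaniplex m) (V : VoltageOperator n m Y) →
    Derived V ≅ Semidirect (U n) V
theorem7p1 n m Y V = record
  { to         = λ (y , g) → g , y
  ; to-cong    = λ (p , q) → q , p
  ; to-adj     = λ i (y , g) → ∼.sym (∼.reflexive (act-U (η i y) g)) , Y.refl
  ; injective  = λ (p , q) → q , p
  ; surjective = λ (g , y) → (y , g) , ∼-refl , Y.refl
  }
  where
    open VoltageOperator V using (η)
    module Y = IsEquivalence (Premaniplex.isEquiv Y)
    module ∼ = IsEquivalence (∼-isEquiv {n})
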